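{- Let $k\ge1$ be an integer and let $(\mathscr{D},\mu)$ be the multiarrangement in $\mathbb{Q}^3$ with defining polynomial $x_1^{2k}x_2^{2k}x_3^{2k}(x_1+x_2)(x_1+x_3)(x_2+x_3)$. Then $(\mathscr{D},\mu)$ is free with exponents $(2k+1,2k+1,2k+1)$.
   Context: For a multiarrangement $(\mathcal{A},\mu)$ in $\mathbb{Q}^\ell$ (hyperplanes $H$ with linear forms $\alpha_H$, $\mu:\mathcal{A}\to\mathbb{Z}_{\ge0}$, defining polynomial $\prod_H\alpha_H^{\mu(H)}$) with $S=\mathbb{Q}[x_1,\dots,x_\ell]$, $D(\mathcal{A},\mu)=\{\theta\in\mathrm{Der}(S):\theta(\alpha_H)\in\alpha_H^{\mu(H)}S\ \forall H\}$. It is free if $D(\mathcal{A},\mu)$ is a free $S$-module; the exponents are the polynomial degrees of a homogeneous basis. -}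

module Defs where

open import Data.Nat as ℕ using (ℕ; zero; suc; _∸_; _<_)
open import Data.Rational as ℚ using (ℚ; 0ℚ; 1ℚ)
open import Data.Fin using (Fin; zero; suc)
open import Data.List using (List; []; _∷_)
open import Data.List.Relation.Unary.All using (All)
open import Data.Product using (Σ; _×_; ∃; ∃-syntax; _,_)
open import Relation.Binary.PropositionalEquality using (_≡_; _≢_)

-- Polynomials in S = ℚ[x₁,x₂,x₃], represented by their coefficient
-- functions: f a b c = coefficient of x₁^a x₂^b x₃^c.

Coeffs : Set
Coeffs = ℕ → ℕ → ℕ → ℚ

IsPoly : Coeffs → Set
IsPoly f = ∃[ N ] (∀ a b c → N < a ℕ.+ b ℕ.+ c → f a b c ≡ 0ℚ)

_≈_ : Coeffs → Coeffs → Set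
f ≈ g = ∀ a b c → f a b c ≡ g a b c

infix 4 _≈_
infixl 6 _⊕_
infixl 7 _⊛_ _·_

sumTo : ℕ → (ℕ → ℚ) → ℚ
sumTo zero    h = h 0
sumTo (suc n) h = sumTo n h ℚ.+ h (suc n)

zeroP : Coeffs
zeroP _ _ _ = 0ℚ

oneP : Coeffs
oneP 0 0 0 = 1ℚ
oneP _ _ _ = 0ℚ

_⊕_ : Coeffs → Coeffs → Coeffs
(f ⊕ g) a b c = f a b c ℚ.+ g a b c

_·_ : ℚ → Coeffs → Coeffs
(q · f) a b c = q ℚ.* f a b c

_⊛_ : Coeffs → Coeffs → Coeffs
(f ⊛ g) a b c =
  sumTo a λ i → sumTo b λ j → sumTo c λ l →
    f i j l ℚ.* g (a ∸ i) (b ∸ j) (c ∸ l)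

_^ᴾ_ : Coeffs → ℕ → Coeffs
f ^ᴾ zero  = oneP
f ^ᴾ suc n = f ⊛ (f ^ᴾ n)

var : Fin 3 → Coeffs
var zero             1 0 0 = 1ℚ
var (suc zero)       0 1 0 = 1ℚ
var (suc (suc zero)) 0 0 1 = 1ℚ
var _                _ _ _ = 0ℚ

IsHomog : ℕ → Coeffs → Set
IsHomog d f = ∀ a b c → a ℕ.+ b ℕ.+ c ≢ d → f a b c ≡ 0ℚ

LinForm : Set
LinForm = Fin 3 → ℚ

linPoly : LinForm → Coeffs
linPoly α = α zero · var zero ⊕ α (suc zero) · var (suc zero)
          ⊕ α (suc (suc zero)) · var (suc (suc zero))

MultiArr : Set
MultiArr = List (LinForm × ℕ)

-- Derivations θ = θ₀ ∂₁ + θ₁ ∂₂ + θ₂ ∂₃ ∈ Der(S)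

Der : Set
Der = Fin 3 → Coeffs

IsDer : Der → Set
IsDer θ = ∀ i → IsPoly (θ i)

applyLin : Der → LinForm → Coeffs
applyLin θ α = α zero · θ zero ⊕ α (suc zero) · θ (suc zero)
             ⊕ α (suc (suc zero)) · θ (suc (suc zero))

InD : MultiArr → Der → Set
InD A θ = IsDer θ × All (λ { (α , m) →
  Σ Coeffs λ g → IsPoly g × (applyLin θ α ≈ (linPoly α ^ᴾ m) ⊛ g) }) A

IsHomogDer : ℕ → Der → Set
IsHomogDer d θ = ∀ i → IsHomog d (θ i)

combo : (Fin 3 → Coeffs) → (Fin 3 → Der) → Der
combo f θ i = f zero ⊛ θ zero i ⊕ f (suc zero) ⊛ θ (suc zero) i
            ⊕ f (suc (suc zero)) ⊛ θ (suc (suc zero)) i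

IsBasis : MultiArr → (Fin 3 → Der) → Set
IsBasis A θ =
  (∀ j → InD A (θ j)) ×
  (∀ η → InD A η →
     Σ (Fin 3 → Coeffs) λ f → (∀ j → IsPoly (f j)) × (∀ i → η i ≈ combo f θ i) ×
       (∀ f′ → (∀ j → IsPoly (f′ j)) → (∀ i → η i ≈ combo f′ θ i) → ∀ j → f j ≈ f′ j))

FreeWithExponents : MultiArr → (Fin 3 → ℕ) → Set
FreeWithExponents A d =
  Σ (Fin 3 → Der) λ θ → IsBasis A θ × (∀ j → IsHomogDer (d j) (θ j))

lf : ℚ → ℚ → ℚ → LinForm
lf p q r zero             = p
lf p q r (suc zero)       = q
lf p q r (suc (suc zero)) = r

𝒟 : ℕ → MultiArr
𝒟 k = (lf 1ℚ 0ℚ 0ℚ , 2 ℕ.* k) ∷ (lf 0ℚ 1ℚ 0ℚ , 2 ℕ.* k) ∷ (lf 0ℚ 0ℚ 1ℚ , 2 ℕ.* k)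
    ∷ (lf 1ℚ 1ℚ 0ℚ , 1) ∷ (lf 1ℚ 0ℚ 1ℚ , 1) ∷ (lf 0ℚ 1ℚ 1ℚ , 1) ∷ []

{-# OPTIONS --safe #-}
module Submission where

-- Write m = 2k and, for t ∈ {1,2,3}, let ℓₜ be the sum of the two variables other than xₜ, so that
-- the defining polynomial is (x₁x₂x₃)ᵐ ℓ₁ℓ₂ℓ₃. The derivations θⱼ = Σᵢ εⱼᵢ xᵢᵐ ℓⱼ ∂ᵢ, with εⱼᵢ = −1
-- if i = j and 1 otherwise, are homogeneous of degree m + 1 and form a basis of D(𝒟, μ).
--
-- The key fact is that, m being even, xₚᵐ g + x_qᵐ h is divisible by xₚ + x_q iff g + h is: both
-- conditions say that a polynomial vanishes on the plane x_q = −xₚ, and xₚᵐ and x_qᵐ agree there.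
-- It gives θⱼ ∈ D directly. Conversely, for η ∈ D write ηᵢ = xᵢᵐ gᵢ; then for ℓₜ = xₚ + x_q the
-- form ℓₜ divides gₚ + g_q, say with quotient rₜ, and fⱼ = rⱼ / 2 solves Σⱼ εⱼᵢ ℓⱼ fⱼ = gᵢ because
-- the matrix J − 2I = (εⱼᵢ) has inverse (J − I) / 2. Hence η = Σⱼ fⱼ θⱼ, and the same inversion,
-- together with cancellation of xᵢᵐ and ℓⱼ, shows that the fⱼ are unique.
--
-- Divisibility by x₂ + x₃ is decided by restricting to x₃ = −x₂ (the factor theorem); the other
-- two linear forms are reduced to this one by permuting the variables.

open import Defs
open import Data.Nat using (ℕ; suc; _*_; _≤_)
open import Data.Nat as ℕ using (zero; _∸_; _<_; z≤n; s≤s; _⊔_)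
import Data.Nat.Properties as ℕ
import Data.Nat.Solver as ℕ-Solver
open import Data.Rational as ℚ using (ℚ; 0ℚ; 1ℚ; ½)
import Data.Rational.Properties as ℚ
open import Data.Rational.Solver using (module +-*-Solver)
open import Algebra.Properties.Group ℚ.+-0-group
  using (⁻¹-involutive; x∙y⁻¹≈ε⇒x≈y; ∙-cancelˡ)
open import Data.Fin as Fin using (Fin; zero; suc)
open import Data.List.Relation.Unary.All using (_∷_; [])
open import Data.Product using (Σ; _×_; _,_; proj₁; proj₂)
open import Function using (_⇔_; mk⇔; Equivalence)
import Function.Properties.Equivalence as ⇔
open import Level using (0ℓ)
open import Relation.Binary.Bundles using (Setoid)
import Relation.Binary.Reasoning.Setoid as SetoidReasoning
open import Relation.Binary.PropositionalEquality
  using (_≡_; _≢_; refl; sym; trans; cong; cong₂; subst; module ≡-Reasoning)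
open import Relation.Nullary using (yes; no; contradiction)

pattern x₁ = zero
pattern x₂ = suc zero
pattern x₃ = suc (suc zero)

open +-*-Solver using (solve; _:+_; _:*_; _:-_; _:=_; con)
open Equivalence using (to; from)

sumTo-cong : ∀ n {h h′ : ℕ → ℚ} → (∀ i → i ≤ n → h i ≡ h′ i) →
  sumTo n h ≡ sumTo n h′
sumTo-cong zero    h≡h′ = h≡h′ 0 z≤n
sumTo-cong (suc n) h≡h′ =
  cong₂ ℚ._+_ (sumTo-cong n λ i i≤n → h≡h′ i (ℕ.m≤n⇒m≤1+n i≤n))
              (h≡h′ (suc n) ℕ.≤-refl)

sumTo-zero : ∀ n {h : ℕ → ℚ} → (∀ i → h i ≡ 0ℚ) → sumTo n h ≡ 0ℚ
sumTo-zero zero    h≡0 = h≡0 0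
sumTo-zero (suc n) h≡0 = cong₂ ℚ._+_ (sumTo-zero n h≡0) (h≡0 (suc n))

sumTo-+ : ∀ n (h h′ : ℕ → ℚ) →
  sumTo n (λ i → h i ℚ.+ h′ i) ≡ sumTo n h ℚ.+ sumTo n h′
sumTo-+ zero    h h′ = refl
sumTo-+ (suc n) h h′ = trans (cong (ℚ._+ (h (suc n) ℚ.+ h′ (suc n))) (sumTo-+ n h h′))
  (solve 4 (λ s s′ x x′ → (s :+ s′) :+ (x :+ x′) := (s :+ x) :+ (s′ :+ x′)) refl
     (sumTo n h) (sumTo n h′) (h (suc n)) (h′ (suc n)))

sumTo-*ˡ : ∀ n q (h : ℕ → ℚ) → sumTo n (λ i → q ℚ.* h i) ≡ q ℚ.* sumTo n h
sumTo-*ˡ zero    q h = refl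
sumTo-*ˡ (suc n) q h = trans (cong (ℚ._+ (q ℚ.* h (suc n))) (sumTo-*ˡ n q h))
  (sym (ℚ.*-distribˡ-+ q (sumTo n h) (h (suc n))))

sumTo-dropHead : ∀ n (h : ℕ → ℚ) → h 0 ≡ 0ℚ → sumTo (suc n) h ≡ sumTo n (λ i → h (suc i))
sumTo-dropHead zero    h h0≡0 = trans (cong (ℚ._+ h 1) h0≡0) (ℚ.+-identityˡ (h 1))
sumTo-dropHead (suc n) h h0≡0 = cong (ℚ._+ h (suc (suc n))) (sumTo-dropHead n h h0≡0)

sumTo-onlyHead : ∀ n (h : ℕ → ℚ) → (∀ i → h (suc i) ≡ 0ℚ) → sumTo n h ≡ h 0
sumTo-onlyHead zero    h _    = refl
sumTo-onlyHead (suc n) h tail≡0 =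
  trans (cong₂ ℚ._+_ (sumTo-onlyHead n h tail≡0) (tail≡0 n)) (ℚ.+-identityʳ (h 0))

sumTo-onlyLast : ∀ n (h : ℕ → ℚ) → (∀ i → i < n → h i ≡ 0ℚ) → sumTo n h ≡ h n
sumTo-onlyLast zero    h _ = refl
sumTo-onlyLast (suc n) h init≡0 = trans
  (cong (ℚ._+ h (suc n))
        (trans (sumTo-cong n λ i i≤n → init≡0 i (s≤s i≤n)) (sumTo-zero n λ _ → refl)))
  (ℚ.+-identityˡ (h (suc n)))

sumTo-antidiagonal-suc : ∀ n (G : ℕ → ℕ → ℚ) → (∀ i → G i 0 ≡ 0ℚ) →
  sumTo (suc n) (λ i → G i (suc n ∸ i)) ≡ sumTo n (λ i → G i (suc (n ∸ i)))
sumTo-antidiagonal-suc n G Gi0≡0 = trans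
  (cong₂ ℚ._+_ (sumTo-cong n λ i i≤n → cong (G i) (ℕ.+-∸-assoc 1 i≤n))
               (trans (cong (G (suc n)) (ℕ.n∸n≡0 n)) (Gi0≡0 (suc n))))
  (ℚ.+-identityʳ _)

sum3 : ℕ → ℕ → ℕ → (ℕ → ℕ → ℕ → ℚ) → ℚ
sum3 a b c F = sumTo a λ i → sumTo b λ j → sumTo c λ l → F i j l

sum3-cong : ∀ a b c {F G : ℕ → ℕ → ℕ → ℚ} → (∀ i j l → F i j l ≡ G i j l) →
  sum3 a b c F ≡ sum3 a b c G
sum3-cong a b c F≡G =
  sumTo-cong a λ i _ → sumTo-cong b λ j _ → sumTo-cong c λ l _ → F≡G i j l

sum3-+ : ∀ a b c (F G : ℕ → ℕ → ℕ → ℚ) →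
  sum3 a b c (λ i j l → F i j l ℚ.+ G i j l) ≡ sum3 a b c F ℚ.+ sum3 a b c G
sum3-+ a b c F G = trans
  (sumTo-cong a λ i _ → trans (sumTo-cong b λ j _ → sumTo-+ c (F i j) (G i j)) (sumTo-+ b _ _))
  (sumTo-+ a _ _)

sum3-*ˡ : ∀ a b c q (F : ℕ → ℕ → ℕ → ℚ) →
  sum3 a b c (λ i j l → q ℚ.* F i j l) ≡ q ℚ.* sum3 a b c F
sum3-*ˡ a b c q F = trans
  (sumTo-cong a λ i _ → trans (sumTo-cong b λ j _ → sumTo-*ˡ c q (F i j)) (sumTo-*ˡ b q _))
  (sumTo-*ˡ a q _)

≈-refl : ∀ {X} → X ≈ X
≈-refl a b c = refl

≈-sym : ∀ {X Y} → X ≈ Y → Y ≈ X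
≈-sym X≈Y a b c = sym (X≈Y a b c)

≈-trans : ∀ {X Y Z} → X ≈ Y → Y ≈ Z → X ≈ Z
≈-trans X≈Y Y≈Z a b c = trans (X≈Y a b c) (Y≈Z a b c)

≈-setoid : Setoid 0ℓ 0ℓ
≈-setoid = record
  { Carrier       = Coeffs
  ; _≈_           = _≈_
  ; isEquivalence = record { refl = ≈-refl ; sym = ≈-sym ; trans = ≈-trans }
  }

module ≈-Reasoning = SetoidReasoning ≈-setoid

⊕-cong : ∀ {X X′ Y Y′} → X ≈ X′ → Y ≈ Y′ → X ⊕ Y ≈ X′ ⊕ Y′
⊕-cong X≈X′ Y≈Y′ a b c = cong₂ ℚ._+_ (X≈X′ a b c) (Y≈Y′ a b c)

·-cong : ∀ q {X Y} → X ≈ Y → q · X ≈ q · Y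
·-cong q X≈Y a b c = cong (q ℚ.*_) (X≈Y a b c)

·-distrib-⊕ : ∀ q X Y → q · (X ⊕ Y) ≈ q · X ⊕ q · Y
·-distrib-⊕ q X Y a b c = ℚ.*-distribˡ-+ q (X a b c) (Y a b c)

⊛-congˡ : ∀ {X X′} g → X ≈ X′ → X ⊛ g ≈ X′ ⊛ g
⊛-congˡ g X≈X′ a b c =
  sum3-cong a b c λ i j l → cong (ℚ._* g (a ∸ i) (b ∸ j) (c ∸ l)) (X≈X′ i j l)

⊛-distribʳ-⊕ : ∀ X Y g → (X ⊕ Y) ⊛ g ≈ X ⊛ g ⊕ Y ⊛ g
⊛-distribʳ-⊕ X Y g a b c = trans
  (sum3-cong a b c λ i j l → ℚ.*-distribʳ-+ (g (a ∸ i) (b ∸ j) (c ∸ l)) (X i j l) (Y i j l))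
  (sum3-+ a b c _ _)

⊛-distribˡ-⊕ : ∀ f X Y → f ⊛ (X ⊕ Y) ≈ f ⊛ X ⊕ f ⊛ Y
⊛-distribˡ-⊕ f X Y a b c = trans
  (sum3-cong a b c λ i j l →
     ℚ.*-distribˡ-+ (f i j l) (X (a ∸ i) (b ∸ j) (c ∸ l)) (Y (a ∸ i) (b ∸ j) (c ∸ l)))
  (sum3-+ a b c _ _)

⊛-·ʳ : ∀ f q X → f ⊛ (q · X) ≈ q · (f ⊛ X)
⊛-·ʳ f q X a b c = trans
  (sum3-cong a b c λ i j l →
     solve 3 (λ x y z → x :* (y :* z) := y :* (x :* z)) refl (f i j l) q (X (a ∸ i) (b ∸ j) (c ∸ l)))
  (sum3-*ˡ a b c q _)

⊛-identityˡ : ∀ g → oneP ⊛ g ≈ g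
⊛-identityˡ g a b c = begin
  (oneP ⊛ g) a b c
    ≡⟨ sumTo-onlyHead a _ (λ i → sumTo-zero b λ j → sumTo-zero c λ l →
         ℚ.*-zeroˡ (g (a ∸ suc i) (b ∸ j) (c ∸ l))) ⟩
  (sumTo b λ j → sumTo c λ l → oneP 0 j l ℚ.* g a (b ∸ j) (c ∸ l))
    ≡⟨ sumTo-onlyHead b _ (λ j → sumTo-zero c λ l → ℚ.*-zeroˡ (g a (b ∸ suc j) (c ∸ l))) ⟩
  (sumTo c λ l → oneP 0 0 l ℚ.* g a b (c ∸ l))
    ≡⟨ sumTo-onlyHead c _ (λ l → ℚ.*-zeroˡ (g a b (c ∸ suc l))) ⟩
  1ℚ ℚ.* g a b c
    ≡⟨ ℚ.*-identityˡ _ ⟩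
  g a b c ∎
  where open ≡-Reasoning

⊛-identityʳ : ∀ f → f ⊛ oneP ≈ f
⊛-identityʳ f a b c = begin
  (f ⊛ oneP) a b c
    ≡⟨ sumTo-onlyLast a _ (λ i i<a → sumTo-zero b λ j → sumTo-zero c λ l →
         vanish (f i j l) (oneP-suc₁ (b ∸ j) (c ∸ l) (ℕ.m<n⇒0<n∸m i<a))) ⟩
  (sumTo b λ j → sumTo c λ l → f a j l ℚ.* oneP (a ∸ a) (b ∸ j) (c ∸ l))
    ≡⟨ sumTo-onlyLast b _ (λ j j<b → sumTo-zero c λ l →
         vanish (f a j l) (oneP-suc₂ (a ∸ a) (c ∸ l) (ℕ.m<n⇒0<n∸m j<b))) ⟩
  (sumTo c λ l → f a b l ℚ.* oneP (a ∸ a) (b ∸ b) (c ∸ l))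
    ≡⟨ sumTo-onlyLast c _ (λ l l<c →
         vanish (f a b l) (oneP-suc₃ (a ∸ a) (b ∸ b) (ℕ.m<n⇒0<n∸m l<c))) ⟩
  f a b c ℚ.* oneP (a ∸ a) (b ∸ b) (c ∸ c)
    ≡⟨ cong (f a b c ℚ.*_) oneP-diagonal ⟩
  f a b c ℚ.* 1ℚ
    ≡⟨ ℚ.*-identityʳ _ ⟩
  f a b c ∎
  where
  open ≡-Reasoning
  vanish : ∀ x {y} → y ≡ 0ℚ → x ℚ.* y ≡ 0ℚ
  vanish x refl = ℚ.*-zeroʳ x
  oneP-suc₁ : ∀ {x} y z → 0 < x → oneP x y z ≡ 0ℚ
  oneP-suc₁ {suc x} _ _ _ = refl
  oneP-suc₂ : ∀ x {y} z → 0 < y → oneP x y z ≡ 0ℚ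
  oneP-suc₂ zero    {suc y} _ _ = refl
  oneP-suc₂ (suc x) {suc y} _ _ = refl
  oneP-suc₃ : ∀ x y {z} → 0 < z → oneP x y z ≡ 0ℚ
  oneP-suc₃ zero    zero    {suc z} _ = refl
  oneP-suc₃ zero    (suc y) {suc z} _ = refl
  oneP-suc₃ (suc x) y       {suc z} _ = refl
  oneP-diagonal : oneP (a ∸ a) (b ∸ b) (c ∸ c) ≡ 1ℚ
  oneP-diagonal rewrite ℕ.n∸n≡0 a | ℕ.n∸n≡0 b | ℕ.n∸n≡0 c = refl

mulVar : Fin 3 → Coeffs → Coeffs
mulVar x₁ X zero    b       c       = 0ℚ
mulVar x₁ X (suc a) b       c       = X a b c
mulVar x₂ X a       zero    c       = 0ℚ
mulVar x₂ X a       (suc b) c       = X a b c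
mulVar x₃ X a       b       zero    = 0ℚ
mulVar x₃ X a       b       (suc c) = X a b c

mulVar-cong : ∀ i {X Y} → X ≈ Y → mulVar i X ≈ mulVar i Y
mulVar-cong x₁ X≈Y zero    b       c       = refl
mulVar-cong x₁ X≈Y (suc a) b       c       = X≈Y a b c
mulVar-cong x₂ X≈Y a       zero    c       = refl
mulVar-cong x₂ X≈Y a       (suc b) c       = X≈Y a b c
mulVar-cong x₃ X≈Y a       b       zero    = refl
mulVar-cong x₃ X≈Y a       b       (suc c) = X≈Y a b c

mulVar-⊕ : ∀ i X Y → mulVar i (X ⊕ Y) ≈ mulVar i X ⊕ mulVar i Y
mulVar-⊕ x₁ X Y zero    b       c       = refl
mulVar-⊕ x₁ X Y (suc a) b       c       = refl
mulVar-⊕ x₂ X Y a       zero    c       = refl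
mulVar-⊕ x₂ X Y a       (suc b) c       = refl
mulVar-⊕ x₃ X Y a       b       zero    = refl
mulVar-⊕ x₃ X Y a       b       (suc c) = refl

mulVar-· : ∀ i q X → mulVar i (q · X) ≈ q · mulVar i X
mulVar-· x₁ q X zero    b       c       = sym (ℚ.*-zeroʳ q)
mulVar-· x₁ q X (suc a) b       c       = refl
mulVar-· x₂ q X a       zero    c       = sym (ℚ.*-zeroʳ q)
mulVar-· x₂ q X a       (suc b) c       = refl
mulVar-· x₃ q X a       b       zero    = sym (ℚ.*-zeroʳ q)
mulVar-· x₃ q X a       b       (suc c) = refl

mulVar-injective : ∀ i {X Y} → mulVar i X ≈ mulVar i Y → X ≈ Y
mulVar-injective x₁ xX≈xY a b c = xX≈xY (suc a) b c
mulVar-injective x₂ xX≈xY a b c = xX≈xY a (suc b) c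
mulVar-injective x₃ xX≈xY a b c = xX≈xY a b (suc c)

mulVar-⊛ : ∀ i X g → mulVar i X ⊛ g ≈ mulVar i (X ⊛ g)
mulVar-⊛ x₁ X g zero b c =
  sumTo-zero b λ j → sumTo-zero c λ l → ℚ.*-zeroˡ (g 0 (b ∸ j) (c ∸ l))
mulVar-⊛ x₁ X g (suc a) b c = sumTo-dropHead a _
  (sumTo-zero b λ j → sumTo-zero c λ l → ℚ.*-zeroˡ (g (suc a) (b ∸ j) (c ∸ l)))
mulVar-⊛ x₂ X g a zero c =
  sumTo-zero a λ i → sumTo-zero c λ l → ℚ.*-zeroˡ (g (a ∸ i) 0 (c ∸ l))
mulVar-⊛ x₂ X g a (suc b) c = sumTo-cong a λ i _ → sumTo-dropHead b _
  (sumTo-zero c λ l → ℚ.*-zeroˡ (g (a ∸ i) (suc b) (c ∸ l)))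
mulVar-⊛ x₃ X g a b zero =
  sumTo-zero a λ i → sumTo-zero b λ j → ℚ.*-zeroˡ (g (a ∸ i) (b ∸ j) 0)
mulVar-⊛ x₃ X g a b (suc c) = sumTo-cong a λ i _ → sumTo-cong b λ j _ →
  sumTo-dropHead c _ (ℚ.*-zeroˡ (g (a ∸ i) (b ∸ j) (suc c)))

⊛-mulVar : ∀ i f X → f ⊛ mulVar i X ≈ mulVar i (f ⊛ X)
⊛-mulVar x₁ f X zero b c =
  sumTo-zero b λ j → sumTo-zero c λ l → ℚ.*-zeroʳ (f 0 j l)
⊛-mulVar x₁ f X (suc a) b c =
  sumTo-antidiagonal-suc a
    (λ i a′ → sumTo b λ j → sumTo c λ l → f i j l ℚ.* mulVar x₁ X a′ (b ∸ j) (c ∸ l))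
    (λ i → sumTo-zero b λ j → sumTo-zero c λ l → ℚ.*-zeroʳ (f i j l))
⊛-mulVar x₂ f X a zero c =
  sumTo-zero a λ i → sumTo-zero c λ l → ℚ.*-zeroʳ (f i 0 l)
⊛-mulVar x₂ f X a (suc b) c = sumTo-cong a λ i _ →
  sumTo-antidiagonal-suc b
    (λ j b′ → sumTo c λ l → f i j l ℚ.* mulVar x₂ X (a ∸ i) b′ (c ∸ l))
    (λ j → sumTo-zero c λ l → ℚ.*-zeroʳ (f i j l))
⊛-mulVar x₃ f X a b zero =
  sumTo-zero a λ i → sumTo-zero b λ j → ℚ.*-zeroʳ (f i j 0)
⊛-mulVar x₃ f X a b (suc c) = sumTo-cong a λ i _ → sumTo-cong b λ j _ →
  sumTo-antidiagonal-suc c (λ l c′ → f i j l ℚ.* mulVar x₃ X (a ∸ i) (b ∸ j) c′)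
    (λ l → ℚ.*-zeroʳ (f i j l))

var≈mulVar : ∀ i → var i ≈ mulVar i oneP
var≈mulVar x₁ 0             b             c             = refl
var≈mulVar x₁ 1             0             0             = refl
var≈mulVar x₁ 1             0             (suc c)       = refl
var≈mulVar x₁ 1             (suc b)       c             = refl
var≈mulVar x₁ (suc (suc a)) b             c             = refl
var≈mulVar x₂ 0             0             c             = refl
var≈mulVar x₂ (suc a)       0             c             = refl
var≈mulVar x₂ 0             1             0             = refl
var≈mulVar x₂ 0             1             (suc c)       = refl
var≈mulVar x₂ (suc a)       1             c             = refl
var≈mulVar x₂ 0             (suc (suc b)) c             = refl
var≈mulVar x₂ (suc a)       (suc (suc b)) c             = refl
var≈mulVar x₃ 0             0             0             = refl
var≈mulVar x₃ 0             (suc b)       0             = refl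
var≈mulVar x₃ (suc a)       b             0             = refl
var≈mulVar x₃ 0             0             1             = refl
var≈mulVar x₃ 0             (suc b)       1             = refl
var≈mulVar x₃ (suc a)       b             1             = refl
var≈mulVar x₃ 0             0             (suc (suc c)) = refl
var≈mulVar x₃ 0             (suc b)       (suc (suc c)) = refl
var≈mulVar x₃ (suc a)       b             (suc (suc c)) = refl

degree-suc₂ : ∀ a b c → a ℕ.+ suc b ℕ.+ c ≡ suc (a ℕ.+ b ℕ.+ c)
degree-suc₂ a b c = cong (ℕ._+ c) (ℕ.+-suc a b)

degree-suc₃ : ∀ a b c → a ℕ.+ b ℕ.+ suc c ≡ suc (a ℕ.+ b ℕ.+ c)
degree-suc₃ a b c = ℕ.+-suc (a ℕ.+ b) c

mulVar-homog : ∀ i {d X} → IsHomog d X → IsHomog (suc d) (mulVar i X)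
mulVar-homog x₁ hX zero    b       c       _  = refl
mulVar-homog x₁ hX (suc a) b       c       ≢d = hX a b c λ ≡d → ≢d (cong suc ≡d)
mulVar-homog x₂ hX a       zero    c       _  = refl
mulVar-homog x₂ hX a       (suc b) c       ≢d =
  hX a b c λ ≡d → ≢d (trans (degree-suc₂ a b c) (cong suc ≡d))
mulVar-homog x₃ hX a       b       zero    _  = refl
mulVar-homog x₃ hX a       b       (suc c) ≢d =
  hX a b c λ ≡d → ≢d (trans (degree-suc₃ a b c) (cong suc ≡d))

mulVar-poly : ∀ i {X} → IsPoly X → IsPoly (mulVar i X)
mulVar-poly i {X} (N , pX) = suc N , bounded i
  where
  bounded : ∀ i a b c → suc N < a ℕ.+ b ℕ.+ c → mulVar i X a b c ≡ 0ℚ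
  bounded x₁ zero    b       c       _ = refl
  bounded x₁ (suc a) b       c       N< = pX a b c (ℕ.s<s⁻¹ N<)
  bounded x₂ a       zero    c       _ = refl
  bounded x₂ a       (suc b) c       N< =
    pX a b c (ℕ.s<s⁻¹ (subst (suc N <_) (degree-suc₂ a b c) N<))
  bounded x₃ a       b       zero    _ = refl
  bounded x₃ a       b       (suc c) N< =
    pX a b c (ℕ.s<s⁻¹ (subst (suc N <_) (degree-suc₃ a b c) N<))

homog⇒poly : ∀ {d X} → IsHomog d X → IsPoly X
homog⇒poly {d} hX = d , λ a b c d< → hX a b c λ ≡d → ℕ.<⇒≢ d< (sym ≡d)

⊕-poly : ∀ {X Y} → IsPoly X → IsPoly Y → IsPoly (X ⊕ Y)
⊕-poly (N , pX) (M , pY) = N ⊔ M , λ a b c N⊔M< →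
  cong₂ ℚ._+_ (pX a b c (ℕ.≤-<-trans (ℕ.m≤m⊔n N M) N⊔M<))
              (pY a b c (ℕ.≤-<-trans (ℕ.m≤n⊔m N M) N⊔M<))

·-poly : ∀ q {X} → IsPoly X → IsPoly (q · X)
·-poly q (N , pX) = N , λ a b c N< → trans (cong (q ℚ.*_) (pX a b c N<)) (ℚ.*-zeroʳ q)

⊕-homog : ∀ {d X Y} → IsHomog d X → IsHomog d Y → IsHomog d (X ⊕ Y)
⊕-homog hX hY a b c ≢d = cong₂ ℚ._+_ (hX a b c ≢d) (hY a b c ≢d)

·-homog : ∀ q {d X} → IsHomog d X → IsHomog d (q · X)
·-homog q hX a b c ≢d = trans (cong (q ℚ.*_) (hX a b c ≢d)) (ℚ.*-zeroʳ q)

oneP-homog : IsHomog 0 oneP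
oneP-homog zero    zero    zero    ≢0 = contradiction refl ≢0
oneP-homog zero    zero    (suc c) _  = refl
oneP-homog zero    (suc b) c       _  = refl
oneP-homog (suc a) b       c       _  = refl

iterate : {A : Set} → (A → A) → ℕ → A → A
iterate F zero    x = x
iterate F (suc n) x = F (iterate F n x)

mulVarⁿ : Fin 3 → ℕ → Coeffs → Coeffs
mulVarⁿ i = iterate (mulVar i)

mulVarⁿ-cong : ∀ i n {X Y} → X ≈ Y → mulVarⁿ i n X ≈ mulVarⁿ i n Y
mulVarⁿ-cong i zero    X≈Y = X≈Y
mulVarⁿ-cong i (suc n) X≈Y = mulVar-cong i (mulVarⁿ-cong i n X≈Y)

mulVarⁿ-⊕ : ∀ i n X Y → mulVarⁿ i n (X ⊕ Y) ≈ mulVarⁿ i n X ⊕ mulVarⁿ i n Y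
mulVarⁿ-⊕ i zero    X Y = ≈-refl
mulVarⁿ-⊕ i (suc n) X Y =
  ≈-trans (mulVar-cong i (mulVarⁿ-⊕ i n X Y)) (mulVar-⊕ i (mulVarⁿ i n X) (mulVarⁿ i n Y))

mulVarⁿ-injective : ∀ i n {X Y} → mulVarⁿ i n X ≈ mulVarⁿ i n Y → X ≈ Y
mulVarⁿ-injective i zero    xX≈xY = xX≈xY
mulVarⁿ-injective i (suc n) xX≈xY = mulVarⁿ-injective i n (mulVar-injective i xX≈xY)

mulVarⁿ-⊛ : ∀ i n X g → mulVarⁿ i n X ⊛ g ≈ mulVarⁿ i n (X ⊛ g)
mulVarⁿ-⊛ i zero    X g = ≈-refl
mulVarⁿ-⊛ i (suc n) X g =
  ≈-trans (mulVar-⊛ i (mulVarⁿ i n X) g) (mulVar-cong i (mulVarⁿ-⊛ i n X g))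

⊛-mulVarⁿ : ∀ i n f X → f ⊛ mulVarⁿ i n X ≈ mulVarⁿ i n (f ⊛ X)
⊛-mulVarⁿ i zero    f X = ≈-refl
⊛-mulVarⁿ i (suc n) f X =
  ≈-trans (⊛-mulVar i f (mulVarⁿ i n X)) (mulVar-cong i (⊛-mulVarⁿ i n f X))

mulVarⁿ-homog : ∀ i n {d X} → IsHomog d X → IsHomog (n ℕ.+ d) (mulVarⁿ i n X)
mulVarⁿ-homog i zero    hX = hX
mulVarⁿ-homog i (suc n) hX = mulVar-homog i (mulVarⁿ-homog i n hX)

mulVarⁿ-poly : ∀ i n {X} → IsPoly X → IsPoly (mulVarⁿ i n X)
mulVarⁿ-poly i zero    pX = pX
mulVarⁿ-poly i (suc n) pX = mulVar-poly i (mulVarⁿ-poly i n pX)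

var-⊛ : ∀ i g → var i ⊛ g ≈ mulVar i g
var-⊛ i g = begin
  var i ⊛ g           ≈⟨ ⊛-congˡ g (var≈mulVar i) ⟩
  mulVar i oneP ⊛ g   ≈⟨ mulVar-⊛ i oneP g ⟩
  mulVar i (oneP ⊛ g) ≈⟨ mulVar-cong i (⊛-identityˡ g) ⟩
  mulVar i g          ∎
  where open ≈-Reasoning

^ᴾ-var : ∀ i {X} → X ≈ var i → ∀ n → X ^ᴾ n ≈ mulVarⁿ i n oneP
^ᴾ-var i X≈xᵢ zero    = ≈-refl
^ᴾ-var i {X} X≈xᵢ (suc n) =
  ≈-trans (⊛-congˡ (X ^ᴾ n) X≈xᵢ)
          (≈-trans (var-⊛ i (X ^ᴾ n)) (mulVar-cong i (^ᴾ-var i X≈xᵢ n)))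

^ᴾ-var-⊛ : ∀ i {X} → X ≈ var i → ∀ n g → (X ^ᴾ n) ⊛ g ≈ mulVarⁿ i n g
^ᴾ-var-⊛ i {X} X≈xᵢ n g = begin
  (X ^ᴾ n) ⊛ g              ≈⟨ ⊛-congˡ g (^ᴾ-var i X≈xᵢ n) ⟩
  mulVarⁿ i n oneP ⊛ g      ≈⟨ mulVarⁿ-⊛ i n oneP g ⟩
  mulVarⁿ i n (oneP ⊛ g)    ≈⟨ mulVarⁿ-cong i n (⊛-identityˡ g) ⟩
  mulVarⁿ i n g             ∎
  where open ≈-Reasoning

other₁ other₂ : Fin 3 → Fin 3
other₁ x₁ = x₂
other₁ x₂ = x₁
other₁ x₃ = x₁
other₂ x₁ = x₃
other₂ x₂ = x₃
other₂ x₃ = x₂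

coordForm pairForm : Fin 3 → LinForm
coordForm x₁ = lf 1ℚ 0ℚ 0ℚ
coordForm x₂ = lf 0ℚ 1ℚ 0ℚ
coordForm x₃ = lf 0ℚ 0ℚ 1ℚ
pairForm x₁ = lf 0ℚ 1ℚ 1ℚ
pairForm x₂ = lf 1ℚ 0ℚ 1ℚ
pairForm x₃ = lf 1ℚ 1ℚ 0ℚ

applyLin-coordForm : ∀ θ i → applyLin θ (coordForm i) ≈ θ i
applyLin-coordForm θ x₁ a b c = solve 3 (λ x y z → con 1ℚ :* x :+ con 0ℚ :* y :+ con 0ℚ :* z := x)
  refl (θ x₁ a b c) (θ x₂ a b c) (θ x₃ a b c)
applyLin-coordForm θ x₂ a b c = solve 3 (λ x y z → con 0ℚ :* x :+ con 1ℚ :* y :+ con 0ℚ :* z := y)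
  refl (θ x₁ a b c) (θ x₂ a b c) (θ x₃ a b c)
applyLin-coordForm θ x₃ a b c = solve 3 (λ x y z → con 0ℚ :* x :+ con 0ℚ :* y :+ con 1ℚ :* z := z)
  refl (θ x₁ a b c) (θ x₂ a b c) (θ x₃ a b c)

applyLin-pairForm : ∀ θ t → applyLin θ (pairForm t) ≈ θ (other₁ t) ⊕ θ (other₂ t)
applyLin-pairForm θ x₁ a b c = solve 3 (λ x y z → con 0ℚ :* x :+ con 1ℚ :* y :+ con 1ℚ :* z := y :+ z)
  refl (θ x₁ a b c) (θ x₂ a b c) (θ x₃ a b c)
applyLin-pairForm θ x₂ a b c = solve 3 (λ x y z → con 1ℚ :* x :+ con 0ℚ :* y :+ con 1ℚ :* z := x :+ z)
  refl (θ x₁ a b c) (θ x₂ a b c) (θ x₃ a b c)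
applyLin-pairForm θ x₃ a b c = solve 3 (λ x y z → con 1ℚ :* x :+ con 1ℚ :* y :+ con 0ℚ :* z := x :+ y)
  refl (θ x₁ a b c) (θ x₂ a b c) (θ x₃ a b c)

mulℓ : Fin 3 → Coeffs → Coeffs
mulℓ t X = mulVar (other₁ t) X ⊕ mulVar (other₂ t) X

coordForm-^ᴾ-⊛ : ∀ i n g → (linPoly (coordForm i) ^ᴾ n) ⊛ g ≈ mulVarⁿ i n g
coordForm-^ᴾ-⊛ i = ^ᴾ-var-⊛ i (applyLin-coordForm var i)

pairForm-⊛ : ∀ t g → (linPoly (pairForm t) ^ᴾ 1) ⊛ g ≈ mulℓ t g
pairForm-⊛ t g = begin
  (ℓ ⊛ oneP) ⊛ g                                   ≈⟨ ⊛-congˡ g (⊛-identityʳ ℓ) ⟩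
  ℓ ⊛ g                                            ≈⟨ ⊛-congˡ g (applyLin-pairForm var t) ⟩
  (var p ⊕ var q) ⊛ g                              ≈⟨ ⊛-distribʳ-⊕ (var p) (var q) g ⟩
  var p ⊛ g ⊕ var q ⊛ g                            ≈⟨ ⊕-cong (var-⊛ p g) (var-⊛ q g) ⟩
  mulℓ t g                                         ∎
  where
  open ≈-Reasoning
  ℓ = linPoly (pairForm t)
  p = other₁ t
  q = other₂ t

⊛-mulℓ-oneP : ∀ t f → f ⊛ mulℓ t oneP ≈ mulℓ t f
⊛-mulℓ-oneP t f = ≈-trans (⊛-distribˡ-⊕ f (mulVar (other₁ t) oneP) (mulVar (other₂ t) oneP))
                           (⊕-cong (oneP-case (other₁ t)) (oneP-case (other₂ t)))
  where
  oneP-case : ∀ i → f ⊛ mulVar i oneP ≈ mulVar i f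
  oneP-case i = ≈-trans (⊛-mulVar i f oneP) (mulVar-cong i (⊛-identityʳ f))

mulℓ-· : ∀ t q X → mulℓ t (q · X) ≈ q · mulℓ t X
mulℓ-· t q X = ≈-trans (⊕-cong (mulVar-· (other₁ t) q X) (mulVar-· (other₂ t) q X))
  (≈-sym (·-distrib-⊕ q (mulVar (other₁ t) X) (mulVar (other₂ t) X)))

mulℓ-homog : ∀ t {d X} → IsHomog d X → IsHomog (suc d) (mulℓ t X)
mulℓ-homog t hX = ⊕-homog (mulVar-homog (other₁ t) hX) (mulVar-homog (other₂ t) hX)

-- Divisibility by x₂ + x₃

Divisible : (Coeffs → Coeffs) → Coeffs → Set
Divisible M P = Σ Coeffs λ r → IsPoly r × (P ≈ M r)

Divisible-resp-≈ : ∀ {M P Q} → P ≈ Q → Divisible M P → Divisible M Q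
Divisible-resp-≈ P≈Q (r , pr , P≈Mr) = r , pr , ≈-trans (≈-sym P≈Q) P≈Mr

quotX₃ : Coeffs → Coeffs
quotX₃ P a b c = P a b (suc c)

iterate-quotX₃ : ∀ n P a b c → iterate quotX₃ n P a b c ≡ P a b (n ℕ.+ c)
iterate-quotX₃ zero    P a b c = refl
iterate-quotX₃ (suc n) P a b c = trans (iterate-quotX₃ n P a b (suc c)) (cong (P a b) (ℕ.+-suc n c))

-- restrict P a n is the coefficient of x₁ᵃ x₂ⁿ in P(x₁, x₂, −x₂).
restrict : Coeffs → ℕ → ℕ → ℚ
restrict P a zero    = P a 0 0
restrict P a (suc n) = P a (suc n) 0 ℚ.- restrict (quotX₃ P) a n

VanishesOnℓ₁ : Coeffs → Set
VanishesOnℓ₁ P = ∀ a n → restrict P a n ≡ 0ℚ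

restrict-cong : ∀ {P Q} → P ≈ Q → ∀ a n → restrict P a n ≡ restrict Q a n
restrict-cong P≈Q a zero    = P≈Q a 0 0
restrict-cong P≈Q a (suc n) =
  cong₂ ℚ._-_ (P≈Q a (suc n) 0) (restrict-cong (λ a b c → P≈Q a b (suc c)) a n)

restrict-⊕ : ∀ P Q a n → restrict (P ⊕ Q) a n ≡ restrict P a n ℚ.+ restrict Q a n
restrict-⊕ P Q a zero    = refl
restrict-⊕ P Q a (suc n) = trans
  (cong (λ y → P a (suc n) 0 ℚ.+ Q a (suc n) 0 ℚ.- y) (restrict-⊕ (quotX₃ P) (quotX₃ Q) a n))
  (solve 4 (λ p q p′ q′ → p :+ q :- (p′ :+ q′) := (p :- p′) :+ (q :- q′)) refl
     (P a (suc n) 0) (Q a (suc n) 0) (restrict (quotX₃ P) a n) (restrict (quotX₃ Q) a n))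

restrict-vanishes : ∀ P a n → (∀ b c → b ℕ.+ c ≡ n → P a b c ≡ 0ℚ) →
  restrict P a n ≡ 0ℚ
restrict-vanishes P a zero    P≡0 = P≡0 0 0 refl
restrict-vanishes P a (suc n) P≡0 = cong₂ ℚ._-_
  (P≡0 (suc n) 0 (ℕ.+-identityʳ (suc n)))
  (restrict-vanishes (quotX₃ P) a n λ b c b+c≡n →
     P≡0 b (suc c) (trans (ℕ.+-suc b c) (cong suc b+c≡n)))

restrict-x₂ : ∀ X a n → restrict (mulVar x₂ X) a (suc n) ≡ restrict X a n
restrict-x₂ X a zero    = ℚ.+-identityʳ (X a 0 0)
restrict-x₂ X a (suc n) = cong (λ y → X a (suc n) 0 ℚ.- y)
  (trans (restrict-cong quotX₃-x₂ a (suc n)) (restrict-x₂ (quotX₃ X) a n))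
  where
  quotX₃-x₂ : quotX₃ (mulVar x₂ X) ≈ mulVar x₂ (quotX₃ X)
  quotX₃-x₂ a zero    c = refl
  quotX₃-x₂ a (suc b) c = refl

restrict-x₃ : ∀ X a n → restrict (mulVar x₃ X) a (suc n) ≡ ℚ.- restrict X a n
restrict-x₃ X a n = ℚ.+-identityˡ (ℚ.- restrict X a n)

restrict-x₃² : ∀ X a n →
  restrict (mulVar x₃ (mulVar x₃ X)) a n ≡ restrict (mulVar x₂ (mulVar x₂ X)) a n
restrict-x₃² X a zero          = refl
restrict-x₃² X a (suc zero)    = refl
restrict-x₃² X a (suc (suc n)) = begin
  restrict (mulVar x₃ (mulVar x₃ X)) a (suc (suc n)) ≡⟨ restrict-x₃ (mulVar x₃ X) a (suc n) ⟩
  ℚ.- restrict (mulVar x₃ X) a (suc n)               ≡⟨ cong ℚ.-_ (restrict-x₃ X a n) ⟩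
  ℚ.- ℚ.- restrict X a n                             ≡⟨ ⁻¹-involutive (restrict X a n) ⟩
  restrict X a n                                     ≡⟨ restrict-x₂ X a n ⟨
  restrict (mulVar x₂ X) a (suc n)                   ≡⟨ restrict-x₂ (mulVar x₂ X) a (suc n) ⟨
  restrict (mulVar x₂ (mulVar x₂ X)) a (suc (suc n)) ∎
  where open ≡-Reasoning

restrict-x₂-cong : ∀ {X Y} a → (∀ n → restrict X a n ≡ restrict Y a n) →
  ∀ n → restrict (mulVar x₂ X) a n ≡ restrict (mulVar x₂ Y) a n
restrict-x₂-cong a X≡Y zero    = refl
restrict-x₂-cong {X} {Y} a X≡Y (suc n) =
  trans (restrict-x₂ X a n) (trans (X≡Y n) (sym (restrict-x₂ Y a n)))

iterate-2*suc : ∀ {A : Set} (F : A → A) k x → iterate F (2 * suc k) x ≡ F (F (iterate F (2 * k) x))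
iterate-2*suc F k x = cong (λ n → iterate F n x) (ℕ.*-suc 2 k)

restrict-evenPower : ∀ k X a n →
  restrict (mulVarⁿ x₃ (2 * k) X) a n ≡ restrict (mulVarⁿ x₂ (2 * k) X) a n
restrict-evenPower zero    X a n = refl
restrict-evenPower (suc k) X a n = begin
  restrict (mulVarⁿ x₃ (2 * suc k) X) a n
    ≡⟨ cong (λ P → restrict P a n) (iterate-2*suc (mulVar x₃) k X) ⟩
  restrict (mulVar x₃ (mulVar x₃ Y₃)) a n
    ≡⟨ restrict-x₃² Y₃ a n ⟩
  restrict (mulVar x₂ (mulVar x₂ Y₃)) a n
    ≡⟨ restrict-x₂-cong a (restrict-x₂-cong a (restrict-evenPower k X a)) n ⟩
  restrict (mulVar x₂ (mulVar x₂ Y₂)) a n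
    ≡⟨ cong (λ P → restrict P a n) (iterate-2*suc (mulVar x₂) k X) ⟨
  restrict (mulVarⁿ x₂ (2 * suc k) X) a n ∎
  where
  open ≡-Reasoning
  Y₂ = mulVarⁿ x₂ (2 * k) X
  Y₃ = mulVarⁿ x₃ (2 * k) X

vanishes-x₂ⁿ⇔ : ∀ n X → VanishesOnℓ₁ (mulVarⁿ x₂ n X) ⇔ VanishesOnℓ₁ X
vanishes-x₂ⁿ⇔ zero    X = ⇔.refl
vanishes-x₂ⁿ⇔ (suc n) X = ⇔.trans (vanishes-x₂⇔ (mulVarⁿ x₂ n X)) (vanishes-x₂ⁿ⇔ n X)
  where
  vanishes-x₂⇔ : ∀ Y → VanishesOnℓ₁ (mulVar x₂ Y) ⇔ VanishesOnℓ₁ Y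
  vanishes-x₂⇔ Y = mk⇔
    (λ x₂Y≡0 a n → trans (sym (restrict-x₂ Y a n)) (x₂Y≡0 a (suc n)))
    (λ { Y≡0 a zero → refl ; Y≡0 a (suc n) → trans (restrict-x₂ Y a n) (Y≡0 a n) })

divisible⇒vanishes : ∀ {P r} → P ≈ mulℓ x₁ r → VanishesOnℓ₁ P
divisible⇒vanishes {P} {r} P≈ℓr a n = trans (restrict-cong P≈ℓr a n) (restrict-ℓ₁ n)
  where
  restrict-ℓ₁ : ∀ n → restrict (mulℓ x₁ r) a n ≡ 0ℚ
  restrict-ℓ₁ zero    = refl
  restrict-ℓ₁ (suc n) = begin
    restrict (mulℓ x₁ r) a (suc n)
      ≡⟨ restrict-⊕ (mulVar x₂ r) (mulVar x₃ r) a (suc n) ⟩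
    restrict (mulVar x₂ r) a (suc n) ℚ.+ restrict (mulVar x₃ r) a (suc n)
      ≡⟨ cong₂ ℚ._+_ (restrict-x₂ r a n) (restrict-x₃ r a n) ⟩
    restrict r a n ℚ.- restrict r a n
      ≡⟨ ℚ.+-inverseʳ (restrict r a n) ⟩
    0ℚ ∎
    where open ≡-Reasoning

-- The coefficient of x₁ᵃ x₂ᵇ x₃ᶜ in P / (x₂ + x₃) is Σᵢ (−1)ⁱ P_{a, b−i, c+1+i}.
quotientByℓ₁ : Coeffs → Coeffs
quotientByℓ₁ P a b c = restrict (iterate quotX₃ (suc c) P) a b

quotientByℓ₁-poly : ∀ {P} → IsPoly P → IsPoly (quotientByℓ₁ P)
quotientByℓ₁-poly {P} (N , pP) = N , λ a b c N< →
  restrict-vanishes _ a b λ b′ c′ b′+c′≡b →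
  trans (iterate-quotX₃ (suc c) P a b′ c′)
        (pP a b′ (suc c ℕ.+ c′) (subst (N <_) (degree a c b′+c′≡b) (ℕ.m<n⇒m<1+n N<)))
  where
  open ℕ-Solver.+-*-Solver using ()
    renaming (solve to solveℕ; _:+_ to _⊹_; _:=_ to _≐_; con to conℕ)
  degree : ∀ a c {b b′ c′} → b′ ℕ.+ c′ ≡ b →
    suc (a ℕ.+ b ℕ.+ c) ≡ a ℕ.+ b′ ℕ.+ (suc c ℕ.+ c′)
  degree a c {b′ = b′} {c′} refl = solveℕ 4
    (λ a b′ c c′ → conℕ 1 ⊹ (a ⊹ (b′ ⊹ c′) ⊹ c) ≐ a ⊹ b′ ⊹ (conℕ 1 ⊹ c ⊹ c′)) refl a b′ c c′

vanishes⇒divisible : ∀ {P} → IsPoly P → VanishesOnℓ₁ P → Divisible (mulℓ x₁) P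
vanishes⇒divisible {P} pP P≡0 = quotientByℓ₁ P , quotientByℓ₁-poly pP , P≈ℓ₁Q
  where
  top : ∀ a b c → iterate quotX₃ c P a b 0 ≡ P a b c
  top a b c = trans (iterate-quotX₃ c P a b 0) (cong (P a b) (ℕ.+-identityʳ c))
  P≈ℓ₁Q : P ≈ mulℓ x₁ (quotientByℓ₁ P)
  P≈ℓ₁Q a zero    zero    = P≡0 a 0
  P≈ℓ₁Q a zero    (suc c) = sym (trans (ℚ.+-identityˡ _) (top a 0 (suc c)))
  P≈ℓ₁Q a (suc b) zero    =
    trans (x∙y⁻¹≈ε⇒x≈y _ _ (P≡0 a (suc b))) (sym (ℚ.+-identityʳ (restrict (quotX₃ P) a b)))
  P≈ℓ₁Q a (suc b) (suc c) = sym (trans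
    (solve 2 (λ x y → y :+ (x :- y) := x) refl
       (iterate quotX₃ (suc c) P a (suc b) 0) (restrict (iterate quotX₃ (suc (suc c)) P) a b))
    (top a (suc b) (suc c)))

divisible⇔vanishes : ∀ {P} → IsPoly P → Divisible (mulℓ x₁) P ⇔ VanishesOnℓ₁ P
divisible⇔vanishes pP =
  mk⇔ (λ (_ , _ , P≈ℓr) → divisible⇒vanishes P≈ℓr) (vanishes⇒divisible pP)

evenPowers-divisible⇔ℓ₁ : ∀ k {g h} → IsPoly g → IsPoly h →
  Divisible (mulℓ x₁) (mulVarⁿ x₂ (2 * k) g ⊕ mulVarⁿ x₃ (2 * k) h) ⇔
  Divisible (mulℓ x₁) (g ⊕ h)
evenPowers-divisible⇔ℓ₁ k {g} {h} pg ph =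
  ⇔.trans (divisible⇔vanishes (⊕-poly (mulVarⁿ-poly x₂ m pg) (mulVarⁿ-poly x₃ m ph)))
  (⇔.trans (mk⇔ (λ v a n → trans (sym (same-restriction a n)) (v a n))
                (λ v a n → trans (same-restriction a n) (v a n)))
  (⇔.trans (vanishes-x₂ⁿ⇔ m (g ⊕ h))
           (⇔.sym (divisible⇔vanishes (⊕-poly pg ph)))))
  where
  m = 2 * k
  same-restriction : ∀ a n →
    restrict (mulVarⁿ x₂ m g ⊕ mulVarⁿ x₃ m h) a n ≡ restrict (mulVarⁿ x₂ m (g ⊕ h)) a n
  same-restriction a n = begin
    restrict (mulVarⁿ x₂ m g ⊕ mulVarⁿ x₃ m h) a n
      ≡⟨ restrict-⊕ (mulVarⁿ x₂ m g) (mulVarⁿ x₃ m h) a n ⟩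
    restrict (mulVarⁿ x₂ m g) a n ℚ.+ restrict (mulVarⁿ x₃ m h) a n
      ≡⟨ cong (restrict (mulVarⁿ x₂ m g) a n ℚ.+_) (restrict-evenPower k h a n) ⟩
    restrict (mulVarⁿ x₂ m g) a n ℚ.+ restrict (mulVarⁿ x₂ m h) a n
      ≡⟨ restrict-⊕ (mulVarⁿ x₂ m g) (mulVarⁿ x₂ m h) a n ⟨
    restrict (mulVarⁿ x₂ m g ⊕ mulVarⁿ x₂ m h) a n
      ≡⟨ restrict-cong (mulVarⁿ-⊕ x₂ m g h) a n ⟨
    restrict (mulVarⁿ x₂ m (g ⊕ h)) a n ∎
    where open ≡-Reasoning

mulℓ₁-cancel : ∀ {X Y} → mulℓ x₁ X ≈ mulℓ x₁ Y → X ≈ Y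
mulℓ₁-cancel {X} {Y} ℓX≈ℓY a zero    c =
  ∙-cancelˡ 0ℚ (X a 0 c) (Y a 0 c) (ℓX≈ℓY a 0 (suc c))
mulℓ₁-cancel {X} {Y} ℓX≈ℓY a (suc b) c =
  ∙-cancelˡ (X a b (suc c)) (X a (suc b) c) (Y a (suc b) c) (trans (ℓX≈ℓY a (suc b) (suc c))
    (cong (ℚ._+ Y a (suc b) c) (sym (mulℓ₁-cancel ℓX≈ℓY a b (suc c)))))

-- Permuting the variables

Divisible-resp⇔ : ∀ {M P Q} → P ≈ Q → Divisible M P ⇔ Divisible M Q
Divisible-resp⇔ P≈Q = mk⇔ (Divisible-resp-≈ P≈Q) (Divisible-resp-≈ (≈-sym P≈Q))

record Relabelling (t : Fin 3) : Set where
  field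
    σ τ      : Coeffs → Coeffs
    σ-cong   : ∀ {X Y} → X ≈ Y → σ X ≈ σ Y
    τ-cong   : ∀ {X Y} → X ≈ Y → τ X ≈ τ Y
    τ∘σ      : ∀ X → τ (σ X) ≈ X
    σ∘τ      : ∀ X → σ (τ X) ≈ X
    σ-⊕      : ∀ X Y → σ (X ⊕ Y) ≈ σ X ⊕ σ Y
    σ-poly   : ∀ {X} → IsPoly X → IsPoly (σ X)
    τ-poly   : ∀ {X} → IsPoly X → IsPoly (τ X)
    σ-other₁ : ∀ X → σ (mulVar (other₁ t) X) ≈ mulVar x₂ (σ X)
    σ-other₂ : ∀ X → σ (mulVar (other₂ t) X) ≈ mulVar x₃ (σ X)

  σ-mulℓ : ∀ X → σ (mulℓ t X) ≈ mulℓ x₁ (σ X)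
  σ-mulℓ X = ≈-trans (σ-⊕ (mulVar (other₁ t) X) (mulVar (other₂ t) X))
                     (⊕-cong (σ-other₁ X) (σ-other₂ X))

  τ-mulℓ : ∀ X → τ (mulℓ x₁ X) ≈ mulℓ t (τ X)
  τ-mulℓ X = begin
    τ (mulℓ x₁ X)
      ≈⟨ τ-cong (⊕-cong (mulVar-cong x₂ (σ∘τ X)) (mulVar-cong x₃ (σ∘τ X))) ⟨
    τ (mulℓ x₁ (σ (τ X)))     ≈⟨ τ-cong (σ-mulℓ (τ X)) ⟨
    τ (σ (mulℓ t (τ X)))      ≈⟨ τ∘σ (mulℓ t (τ X)) ⟩
    mulℓ t (τ X)              ∎
    where open ≈-Reasoning

  σ-mulVarⁿ : ∀ i j → (∀ X → σ (mulVar i X) ≈ mulVar j (σ X)) →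
    ∀ n X → σ (mulVarⁿ i n X) ≈ mulVarⁿ j n (σ X)
  σ-mulVarⁿ i j σ-i zero    X = ≈-refl
  σ-mulVarⁿ i j σ-i (suc n) X =
    ≈-trans (σ-i (mulVarⁿ i n X)) (mulVar-cong j (σ-mulVarⁿ i j σ-i n X))

  divisible⇔ : ∀ P → Divisible (mulℓ t) P ⇔ Divisible (mulℓ x₁) (σ P)
  divisible⇔ P = mk⇔
    (λ (r , pr , P≈ℓr) → σ r , σ-poly pr , ≈-trans (σ-cong P≈ℓr) (σ-mulℓ r))
    (λ (r , pr , σP≈ℓr) → τ r , τ-poly pr ,
       ≈-trans (≈-sym (τ∘σ P)) (≈-trans (τ-cong σP≈ℓr) (τ-mulℓ r)))

  mulℓ-cancel : ∀ {X Y} → mulℓ t X ≈ mulℓ t Y → X ≈ Y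
  mulℓ-cancel {X} {Y} ℓX≈ℓY = begin
    X         ≈⟨ τ∘σ X ⟨
    τ (σ X)   ≈⟨ τ-cong (mulℓ₁-cancel (≈-trans (≈-sym (σ-mulℓ X))
                                        (≈-trans (σ-cong ℓX≈ℓY) (σ-mulℓ Y)))) ⟩
    τ (σ Y)   ≈⟨ τ∘σ Y ⟩
    Y         ∎
    where open ≈-Reasoning

  evenPowers-divisible⇔ : ∀ k {g h} → IsPoly g → IsPoly h →
    Divisible (mulℓ t) (mulVarⁿ (other₁ t) (2 * k) g ⊕ mulVarⁿ (other₂ t) (2 * k) h) ⇔
    Divisible (mulℓ t) (g ⊕ h)
  evenPowers-divisible⇔ k {g} {h} pg ph =
    ⇔.trans (divisible⇔ (mulVarⁿ p m g ⊕ mulVarⁿ q m h))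
    (⇔.trans (Divisible-resp⇔ σ-evenPowers)
    (⇔.trans (evenPowers-divisible⇔ℓ₁ k (σ-poly pg) (σ-poly ph))
    (⇔.trans (Divisible-resp⇔ (≈-sym (σ-⊕ g h)))
             (⇔.sym (divisible⇔ (g ⊕ h))))))
    where
    m = 2 * k
    p = other₁ t
    q = other₂ t
    σ-evenPowers : σ (mulVarⁿ p m g ⊕ mulVarⁿ q m h) ≈ mulVarⁿ x₂ m (σ g) ⊕ mulVarⁿ x₃ m (σ h)
    σ-evenPowers = ≈-trans (σ-⊕ (mulVarⁿ p m g) (mulVarⁿ q m h))
                           (⊕-cong (σ-mulVarⁿ p x₂ σ-other₁ m g) (σ-mulVarⁿ q x₃ σ-other₂ m h))

relabelling : ∀ t → Relabelling t
relabelling x₁ = record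
  { σ = λ X → X ; τ = λ X → X
  ; σ-cong = λ X≈Y → X≈Y ; τ-cong = λ X≈Y → X≈Y
  ; τ∘σ = λ _ → ≈-refl ; σ∘τ = λ _ → ≈-refl ; σ-⊕ = λ _ _ → ≈-refl
  ; σ-poly = λ pX → pX ; τ-poly = λ pX → pX
  ; σ-other₁ = λ _ → ≈-refl ; σ-other₂ = λ _ → ≈-refl
  }
relabelling x₂ = record
  { σ = swap₁₂ ; τ = swap₁₂
  ; σ-cong = λ X≈Y a b c → X≈Y b a c ; τ-cong = λ X≈Y a b c → X≈Y b a c
  ; τ∘σ = λ _ → ≈-refl ; σ∘τ = λ _ → ≈-refl ; σ-⊕ = λ _ _ → ≈-refl
  ; σ-poly = swap₁₂-poly ; τ-poly = swap₁₂-poly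
  ; σ-other₁ = swap₁₂-x₁ ; σ-other₂ = swap₁₂-x₃
  }
  where
  swap₁₂ : Coeffs → Coeffs
  swap₁₂ X a b c = X b a c
  swap₁₂-poly : ∀ {X} → IsPoly X → IsPoly (swap₁₂ X)
  swap₁₂-poly (N , pX) = N , λ a b c N< → pX b a c (subst (N <_) (cong (ℕ._+ c) (ℕ.+-comm a b)) N<)
  swap₁₂-x₁ : ∀ X → swap₁₂ (mulVar x₁ X) ≈ mulVar x₂ (swap₁₂ X)
  swap₁₂-x₁ X a zero    c = refl
  swap₁₂-x₁ X a (suc b) c = refl
  swap₁₂-x₃ : ∀ X → swap₁₂ (mulVar x₃ X) ≈ mulVar x₃ (swap₁₂ X)
  swap₁₂-x₃ X a b zero    = refl
  swap₁₂-x₃ X a b (suc c) = refl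
relabelling x₃ = record
  { σ = rotate ; τ = rotate⁻¹
  ; σ-cong = λ X≈Y a b c → X≈Y b c a ; τ-cong = λ X≈Y a b c → X≈Y c a b
  ; τ∘σ = λ _ → ≈-refl ; σ∘τ = λ _ → ≈-refl ; σ-⊕ = λ _ _ → ≈-refl
  ; σ-poly = rotate-poly ; τ-poly = rotate⁻¹-poly
  ; σ-other₁ = rotate-x₁ ; σ-other₂ = rotate-x₂
  }
  where
  rotate rotate⁻¹ : Coeffs → Coeffs
  rotate   X a b c = X b c a
  rotate⁻¹ X a b c = X c a b
  rotate-poly : ∀ {X} → IsPoly X → IsPoly (rotate X)
  rotate-poly (N , pX) = N , λ a b c N< →
    pX b c a (subst (N <_) (trans (ℕ.+-assoc a b c) (ℕ.+-comm a (b ℕ.+ c))) N<)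
  rotate⁻¹-poly : ∀ {X} → IsPoly X → IsPoly (rotate⁻¹ X)
  rotate⁻¹-poly (N , pX) = N , λ a b c N< →
    pX c a b (subst (N <_) (trans (ℕ.+-comm (a ℕ.+ b) c) (sym (ℕ.+-assoc c a b))) N<)
  rotate-x₁ : ∀ X → rotate (mulVar x₁ X) ≈ mulVar x₂ (rotate X)
  rotate-x₁ X a zero    c = refl
  rotate-x₁ X a (suc b) c = refl
  rotate-x₂ : ∀ X → rotate (mulVar x₂ X) ≈ mulVar x₃ (rotate X)
  rotate-x₂ X a b zero    = refl
  rotate-x₂ X a b (suc c) = refl

evenPowers-divisible⇔ : ∀ t k {g h} → IsPoly g → IsPoly h →
  Divisible (mulℓ t) (mulVarⁿ (other₁ t) (2 * k) g ⊕ mulVarⁿ (other₂ t) (2 * k) h) ⇔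
  Divisible (mulℓ t) (g ⊕ h)
evenPowers-divisible⇔ t = Relabelling.evenPowers-divisible⇔ (relabelling t)

mulℓ-cancel : ∀ t {X Y} → mulℓ t X ≈ mulℓ t Y → X ≈ Y
mulℓ-cancel t = Relabelling.mulℓ-cancel (relabelling t)

-- The sign matrix

sign : Fin 3 → Fin 3 → ℚ
sign j i with j Fin.≟ i
... | yes _ = ℚ.- 1ℚ
... | no  _ = 1ℚ

mix : (Fin 3 → ℚ) → Fin 3 → ℚ
mix h i = sign x₁ i ℚ.* h x₁ ℚ.+ sign x₂ i ℚ.* h x₂ ℚ.+ sign x₃ i ℚ.* h x₃

unmix : (Fin 3 → ℚ) → Fin 3 → ℚ
unmix g j = ½ ℚ.* (g (other₁ j) ℚ.+ g (other₂ j))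

mix-cong : ∀ {h h′} → (∀ j → h j ≡ h′ j) → ∀ i → mix h i ≡ mix h′ i
mix-cong h≡h′ i = cong₂ ℚ._+_ (cong₂ ℚ._+_ (term x₁) (term x₂)) (term x₃)
  where term = λ j → cong (sign j i ℚ.*_) (h≡h′ j)

mix-unmix : ∀ g i → mix (unmix g) i ≡ g i
mix-unmix g x₁ = solve 3 (λ x y z →
    con (ℚ.- 1ℚ) :* (con ½ :* (y :+ z)) :+ con 1ℚ :* (con ½ :* (x :+ z))
      :+ con 1ℚ :* (con ½ :* (x :+ y)) := x)
  refl (g x₁) (g x₂) (g x₃)
mix-unmix g x₂ = solve 3 (λ x y z →
    con 1ℚ :* (con ½ :* (y :+ z)) :+ con (ℚ.- 1ℚ) :* (con ½ :* (x :+ z))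
      :+ con 1ℚ :* (con ½ :* (x :+ y)) := y)
  refl (g x₁) (g x₂) (g x₃)
mix-unmix g x₃ = solve 3 (λ x y z →
    con 1ℚ :* (con ½ :* (y :+ z)) :+ con 1ℚ :* (con ½ :* (x :+ z))
      :+ con (ℚ.- 1ℚ) :* (con ½ :* (x :+ y)) := z)
  refl (g x₁) (g x₂) (g x₃)

unmix-mix : ∀ h j → unmix (mix h) j ≡ h j
unmix-mix h x₁ = solve 3 (λ x y z →
    con ½ :* ((con 1ℚ :* x :+ con (ℚ.- 1ℚ) :* y :+ con 1ℚ :* z)
              :+ (con 1ℚ :* x :+ con 1ℚ :* y :+ con (ℚ.- 1ℚ) :* z)) := x)
  refl (h x₁) (h x₂) (h x₃)
unmix-mix h x₂ = solve 3 (λ x y z →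
    con ½ :* ((con (ℚ.- 1ℚ) :* x :+ con 1ℚ :* y :+ con 1ℚ :* z)
              :+ (con 1ℚ :* x :+ con 1ℚ :* y :+ con (ℚ.- 1ℚ) :* z)) := y)
  refl (h x₁) (h x₂) (h x₃)
unmix-mix h x₃ = solve 3 (λ x y z →
    con ½ :* ((con (ℚ.- 1ℚ) :* x :+ con 1ℚ :* y :+ con 1ℚ :* z)
              :+ (con 1ℚ :* x :+ con (ℚ.- 1ℚ) :* y :+ con 1ℚ :* z)) := z)
  refl (h x₁) (h x₂) (h x₃)

sign-pairSum : ∀ j t → j ≢ t → sign j (other₁ t) ℚ.+ sign j (other₂ t) ≡ 0ℚ
sign-pairSum x₁ x₁ j≢t = contradiction refl j≢t
sign-pairSum x₁ x₂ _   = refl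
sign-pairSum x₁ x₃ _   = refl
sign-pairSum x₂ x₁ _   = refl
sign-pairSum x₂ x₂ j≢t = contradiction refl j≢t
sign-pairSum x₂ x₃ _   = refl
sign-pairSum x₃ x₁ _   = refl
sign-pairSum x₃ x₂ _   = refl
sign-pairSum x₃ x₃ j≢t = contradiction refl j≢t

-- The basis

Divisible-cong⇔ : ∀ {M N P Q} → P ≈ Q → (∀ r → M r ≈ N r) → Divisible M P ⇔ Divisible N Q
Divisible-cong⇔ P≈Q M≈N = mk⇔
  (λ (r , pr , P≈Mr) → r , pr , ≈-trans (≈-sym P≈Q) (≈-trans P≈Mr (M≈N r)))
  (λ (r , pr , Q≈Nr) → r , pr , ≈-trans P≈Q (≈-trans Q≈Nr (≈-sym (M≈N r))))

record In𝒟 (k : ℕ) (η : Der) : Set where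
  field
    isDer : IsDer η
    coord : ∀ i → Divisible (mulVarⁿ i (2 * k)) (η i)
    pair  : ∀ t → Divisible (mulℓ t) (η (other₁ t) ⊕ η (other₂ t))

InD-𝒟⇔In𝒟 : ∀ k η → InD (𝒟 k) η ⇔ In𝒟 k η
InD-𝒟⇔In𝒟 k η = mk⇔
  (λ { (isDer , c₁ ∷ c₂ ∷ c₃ ∷ p₃ ∷ p₂ ∷ p₁ ∷ []) → record
    { isDer = isDer
    ; coord = λ { x₁ → to (coord⇔ x₁) c₁
                ; x₂ → to (coord⇔ x₂) c₂
                ; x₃ → to (coord⇔ x₃) c₃ }
    ; pair  = λ { x₁ → to (pair⇔ x₁) p₁
                ; x₂ → to (pair⇔ x₂) p₂
                ; x₃ → to (pair⇔ x₃) p₃ }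
    } })
  (λ η∈ → let open In𝒟 η∈ in
    isDer , from (coord⇔ x₁) (coord x₁) ∷ from (coord⇔ x₂) (coord x₂)
          ∷ from (coord⇔ x₃) (coord x₃) ∷ from (pair⇔ x₃) (pair x₃)
          ∷ from (pair⇔ x₂) (pair x₂) ∷ from (pair⇔ x₁) (pair x₁) ∷ [])
  where
  coord⇔ : ∀ i → Divisible ((linPoly (coordForm i) ^ᴾ (2 * k)) ⊛_) (applyLin η (coordForm i)) ⇔
                 Divisible (mulVarⁿ i (2 * k)) (η i)
  coord⇔ i = Divisible-cong⇔ (applyLin-coordForm η i) (coordForm-^ᴾ-⊛ i (2 * k))
  pair⇔ : ∀ t → Divisible ((linPoly (pairForm t) ^ᴾ 1) ⊛_) (applyLin η (pairForm t)) ⇔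
                Divisible (mulℓ t) (η (other₁ t) ⊕ η (other₂ t))
  pair⇔ t = Divisible-cong⇔ (applyLin-pairForm η t) (pairForm-⊛ t)

module Basis (k : ℕ) where

  m : ℕ
  m = 2 * k

  θ : Fin 3 → Der
  θ j i = mulVarⁿ i m (sign j i · mulℓ j oneP)

  cofactor : (Fin 3 → Coeffs) → Fin 3 → Coeffs
  cofactor f i =
    sign x₁ i · mulℓ x₁ (f x₁) ⊕ sign x₂ i · mulℓ x₂ (f x₂) ⊕ sign x₃ i · mulℓ x₃ (f x₃)

  θ-homog : ∀ j → IsHomogDer (suc m) (θ j)
  θ-homog j i = subst (λ d → IsHomog d (θ j i)) (ℕ.+-comm m 1)
    (mulVarⁿ-homog i m (·-homog (sign j i) (mulℓ-homog j oneP-homog)))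

  combo-θ : ∀ f i → combo f θ i ≈ mulVarⁿ i m (cofactor f i)
  combo-θ f i = begin
    combo f θ i
      ≈⟨ ⊕-cong (⊕-cong (term x₁) (term x₂)) (term x₃) ⟩
    mulVarⁿ i m (A x₁) ⊕ mulVarⁿ i m (A x₂) ⊕ mulVarⁿ i m (A x₃)
      ≈⟨ ⊕-cong (mulVarⁿ-⊕ i m (A x₁) (A x₂)) ≈-refl ⟨
    mulVarⁿ i m (A x₁ ⊕ A x₂) ⊕ mulVarⁿ i m (A x₃)
      ≈⟨ mulVarⁿ-⊕ i m (A x₁ ⊕ A x₂) (A x₃) ⟨
    mulVarⁿ i m (cofactor f i) ∎
    where
    open ≈-Reasoning
    A : Fin 3 → Coeffs
    A j = sign j i · mulℓ j (f j)
    term : ∀ j → f j ⊛ θ j i ≈ mulVarⁿ i m (A j)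
    term j = ≈-trans (⊛-mulVarⁿ i m (f j) (sign j i · mulℓ j oneP)) (mulVarⁿ-cong i m
      (≈-trans (⊛-·ʳ (f j) (sign j i) (mulℓ j oneP)) (·-cong (sign j i) (⊛-mulℓ-oneP j (f j)))))

  θ-In𝒟 : ∀ j → In𝒟 k (θ j)
  θ-In𝒟 j = record
    { isDer = λ i → homog⇒poly (θ-homog j i)
    ; coord = λ i → g i , g-poly i , ≈-refl
    ; pair  = λ t → from (evenPowers-divisible⇔ t k (g-poly (other₁ t)) (g-poly (other₂ t)))
                         (pairQuotient t)
    }
    where
    g : Fin 3 → Coeffs
    g i = sign j i · mulℓ j oneP
    g-poly : ∀ i → IsPoly (g i)
    g-poly i = homog⇒poly (·-homog (sign j i) (mulℓ-homog j oneP-homog))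
    pairQuotient : ∀ t → Divisible (mulℓ t) (g (other₁ t) ⊕ g (other₂ t))
    pairQuotient t = s · oneP , ·-poly s (homog⇒poly oneP-homog) , (begin
      g p ⊕ g q         ≈⟨ (λ a b c → sym (ℚ.*-distribʳ-+ (mulℓ j oneP a b c) (sign j p) (sign j q))) ⟩
      s · mulℓ j oneP   ≈⟨ j≡t-or-cancel ⟩
      s · mulℓ t oneP   ≈⟨ mulℓ-· t s oneP ⟨
      mulℓ t (s · oneP) ∎)
      where
      open ≈-Reasoning
      p = other₁ t
      q = other₂ t
      s = sign j p ℚ.+ sign j q
      j≡t-or-cancel : s · mulℓ j oneP ≈ s · mulℓ t oneP
      j≡t-or-cancel with j Fin.≟ t
      ... | yes refl = ≈-refl
      ... | no  j≢t  = λ a b c →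
        trans (s≡0-kills (mulℓ j oneP a b c)) (sym (s≡0-kills (mulℓ t oneP a b c)))
        where
        s≡0-kills : ∀ x → s ℚ.* x ≡ 0ℚ
        s≡0-kills x = trans (cong (ℚ._* x) (sign-pairSum j t j≢t)) (ℚ.*-zeroˡ x)

  θ-spans : ∀ {η} → In𝒟 k η →
    Σ (Fin 3 → Coeffs) λ f → (∀ j → IsPoly (f j)) × (∀ i → η i ≈ combo f θ i)
  θ-spans {η} η∈ = f , (λ t → ·-poly ½ (r-poly t)) , η≈combo
    where
    open In𝒟 η∈
    g : Fin 3 → Coeffs
    g i = proj₁ (coord i)
    g-poly : ∀ i → IsPoly (g i)
    g-poly i = proj₁ (proj₂ (coord i))
    η≈xᵐg : ∀ i → η i ≈ mulVarⁿ i m (g i)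
    η≈xᵐg i = proj₂ (proj₂ (coord i))
    pairQuotient : ∀ t → Divisible (mulℓ t) (g (other₁ t) ⊕ g (other₂ t))
    pairQuotient t = to (evenPowers-divisible⇔ t k (g-poly (other₁ t)) (g-poly (other₂ t)))
      (Divisible-resp-≈ (⊕-cong (η≈xᵐg (other₁ t)) (η≈xᵐg (other₂ t))) (pair t))
    r : Fin 3 → Coeffs
    r t = proj₁ (pairQuotient t)
    r-poly : ∀ t → IsPoly (r t)
    r-poly t = proj₁ (proj₂ (pairQuotient t))
    f : Fin 3 → Coeffs
    f t = ½ · r t
    ℓf≈unmix-g : ∀ j → mulℓ j (f j) ≈ ½ · (g (other₁ j) ⊕ g (other₂ j))
    ℓf≈unmix-g j =
      ≈-trans (mulℓ-· j ½ (r j)) (·-cong ½ (≈-sym (proj₂ (proj₂ (pairQuotient j)))))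
    cofactor≈g : ∀ i → cofactor f i ≈ g i
    cofactor≈g i a b c =
      trans (mix-cong (λ j → ℓf≈unmix-g j a b c) i) (mix-unmix (λ i′ → g i′ a b c) i)
    η≈combo : ∀ i → η i ≈ combo f θ i
    η≈combo i = ≈-trans (η≈xᵐg i)
      (≈-trans (mulVarⁿ-cong i m (≈-sym (cofactor≈g i))) (≈-sym (combo-θ f i)))

  θ-independent : ∀ f f′ → (∀ i → combo f θ i ≈ combo f′ θ i) → ∀ j → f j ≈ f′ j
  θ-independent f f′ same-combo j = mulℓ-cancel j λ a b c → begin
    mulℓ j (f j) a b c          ≡⟨ unmix-mix (ℓf a b c) j ⟨
    unmix (mix (ℓf a b c)) j    ≡⟨ cong₂ (λ u v → ½ ℚ.* (u ℚ.+ v)) (same-cofactor (other₁ j) a b c)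
                                                                     (same-cofactor (other₂ j) a b c) ⟩
    unmix (mix (ℓf′ a b c)) j   ≡⟨ unmix-mix (ℓf′ a b c) j ⟩
    mulℓ j (f′ j) a b c         ∎
    where
    open ≡-Reasoning
    ℓf ℓf′ : ℕ → ℕ → ℕ → Fin 3 → ℚ
    ℓf  a b c j = mulℓ j (f j) a b c
    ℓf′ a b c j = mulℓ j (f′ j) a b c
    same-cofactor : ∀ i → cofactor f i ≈ cofactor f′ i
    same-cofactor i = mulVarⁿ-injective i m
      (≈-trans (≈-sym (combo-θ f i)) (≈-trans (same-combo i) (combo-θ f′ i)))

  θ-basis : IsBasis (𝒟 k) θ
  θ-basis = (λ j → from (InD-𝒟⇔In𝒟 k (θ j)) (θ-In𝒟 j)) , λ η η∈D →
    let (f , f-poly , η≈combo) = θ-spans (to (InD-𝒟⇔In𝒟 k η) η∈D) in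
    f , f-poly , η≈combo , λ f′ _ η≈combo′ →
      θ-independent f f′ (λ i → ≈-trans (≈-sym (η≈combo i)) (η≈combo′ i))

𝒟-free : ∀ k → FreeWithExponents (𝒟 k) (λ _ → suc (2 * k))
𝒟-free k = θ , θ-basis , θ-homog
  where open Basis k

proposition5p3 : (k : ℕ) → 1 ≤ k →
    FreeWithExponents (𝒟 k) (λ _ → suc (2 * k))
proposition5p3 k _ = 𝒟-free k
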